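{- Let $\mathsf X\subseteq\{\mathsf M,\mathsf{M_0},\mathsf P,\mathsf{P_0},\mathsf R\}$. Assume that for every finite set $\mathcal D$ of formulas closed under subformulas and single negations with $\top\in\mathcal D$, the $\mathsf{ILX}$-structure for $\mathcal D$ satisfies the frame condition $(\mathsf Y)_{\mathsf{gen}}$ for every $\mathsf Y\in\mathsf X$. Then $\mathsf{ILX}$ is complete with respect to generalized Veltman models satisfying $(\mathsf Y)_{\mathsf{gen}}$ for all $\mathsf Y\in\mathsf X$: every formula forced at every world of every such model is provable in $\mathsf{ILX}$.
   Context: Modal formulas are built from propositional variables, $\bot$, $\to$ and binary $\rhd$; $\Box A$ abbreviates $\neg A\rhd\bot$, $\Diamond A$ abbreviates $\neg\Box\neg A$. $\mathsf{IL}$ has as axioms all instances of classical tautologies and of: $\Box(A\to B)\to(\Box A\to\Box B)$; $\Box(\Box A\to A)\to\Box A$; $\Box(A\to B)\to A\rhd B$; $(A\rhd B)\wedge(B\rhd C)\to A\rhd C$; $(A\rhd C)\wedge(B\rhd C)\to A\vee B\rhd C$; $A\rhd B\to(\Diamond A\to\Diamond B)$; $\Diamond A\rhd A$; rules modus ponens and necessitation. $\mathsf{ILX}$ is $\mathsf{IL}$ plus all instances of the schemata in $\mathsf X$: $\mathsf M$: $A\rhd B\to A\wedge\Box C\rhd B\wedge\Box C$; $\mathsf{M_0}$: $A\rhd B\to\Diamond A\wedge\Box C\rhd B\wedge\Box C$; $\mathsf P$: $A\rhd B\to\Box(A\rhd B)$; $\mathsf{P_0}$: $A\rhd\Diamond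 B\to\Box(A\rhd B)$; $\mathsf R$: $A\rhd B\to\neg(A\rhd\neg C)\rhd B\wedge\Box C$. Generalized Veltman frames/models: $(W,R,\{S_w\})$ with $W\ne\emptyset$, $R$ transitive and conversely well-founded, $R[w]=\{x:wRx\}$, and (a) $S_w\subseteq R[w]\times(\mathcal P(R[w])\setminus\{\emptyset\})$; (b) $wRu\Rightarrow uS_w\{u\}$; (c) $uS_wV$ and $vS_wZ_v$ for all $v\in V$ imply $uS_w\bigcup_vZ_v$; (d) $wRuRv\Rightarrow uS_w\{v\}$; (e) $uS_wV$, $V\subseteq Z\subseteq R[w]$ imply $uS_wZ$; a model adds a valuation, and $w\Vdash A\rhd B$ iff for all $u$ with $wRu$, $u\Vdash A$ there is $V$ with $uS_wV$ and $V\Vdash B$ (all elements force $B$). $R[V]=\bigcup_{v\in V}R[v]$. Frame conditions (universally quantified over all worlds and sets): $(\mathsf M)_{\mathsf{gen}}$: $uS_wV\Rightarrow\exists V'\subseteq V(uS_wV'\wedge R[V']\subseteq R[u])$; $(\mathsf{M_0})_{\mathsf{gen}}$: $wRuRxS_wV\Rightarrow\exists V'\subseteq V(uS_wV'\wedge R[V']\subseteq R[u])$; $(\mathsf P)_{\mathsf{gen}}$: $wRw'RuS_wV\Rightarrow\exists V'\subseteq V\ uS_{w'}V'$; $(\mathsf{P_0})_{\mathsf{gen}}$: $wRxRuS_wV$ and $R[v]\cap Z\neq\emptyset$ for all $v\in V$ imply $\exists Z'\subseteq Z\ uS_xZ'$; $(\mathsf R)_{\mathsf{gen}}$: $wRxRuS_wV\Rightarrow$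 for every $C\in\mathcal C(x,u)$ there is $U\subseteq V$ with $xS_wU$ and $R[U]\subseteq C$, where $\mathcal C(x,u)=\{C\subseteq R[x]:\forall Z(uS_xZ\Rightarrow Z\cap C\neq\emptyset)\}$. Closed under single negations: $B\in\mathcal D\Rightarrow{\sim}B\in\mathcal D$ with ${\sim}\neg C=C$ and ${\sim}B=\neg B$ otherwise. For maximal $\mathsf{ILX}$-consistent sets (MCSs) $w,u$ and a set $S$ of formulas, $w\prec_S u$ iff for all finite $S'\subseteq S$ and all $A$, $A\rhd\bigvee_{G\in S'}\neg G\in w$ implies $\neg A,\Box\neg A\in u$; $w\prec u$ means $w\prec_\emptyset u$. The $\mathsf{ILX}$-structure for $\mathcal D$: $W$ = MCSs containing $G\wedge\Box\neg G$ for some $G\in\mathcal D$; $wRu$ iff $w\prec u$; $uS_wV$ iff $wRu$, $V\subseteq R[w]$, and for every $S$ with $w\prec_Su$ some $v\in V$ has $w\prec_Sv$; $w\Vdash p$ iff $p\in w$. -}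

module Defs where

open import Level using (Level; _⊔_; Lift; 0ℓ) renaming (suc to lsuc)
open import Data.Nat using (ℕ)
open import Data.Bool using (Bool; true; false; not; _∨_)
open import Data.Empty using (⊥)
open import Data.Unit using (⊤)
open import Data.Product using (Σ; ∃; _×_; _,_)
open import Data.List using (List; []; _∷_; foldr; map)
open import Data.List.Relation.Unary.All using (All)
open import Data.List.Membership.Propositional using (_∈_)
open import Relation.Binary.PropositionalEquality using (_≡_)
open import Relation.Nullary using (¬_)
open import Induction.WellFounded using (WellFounded)

infixr 5 _⇒_
infix 6 _▷_

data Fm : Set where
  var : ℕ → Fm
  ⊥' : Fm
  _⇒_ : Fm → Fm → Fm
  _▷_ : Fm → Fm → Fm

¬' : Fm → Fm
¬' A = A ⇒ ⊥'

⊤' : Fm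
⊤' = ¬' ⊥'

_∨'_ : Fm → Fm → Fm
A ∨' B = ¬' A ⇒ B

_∧'_ : Fm → Fm → Fm
A ∧' B = ¬' (A ⇒ ¬' B)

□ : Fm → Fm
□ A = ¬' A ▷ ⊥'

◇ : Fm → Fm
◇ A = ¬' (□ (¬' A))

⋁ : List Fm → Fm
⋁ = foldr _∨'_ ⊥'

_⇒*_ : List Fm → Fm → Fm
Γ ⇒* B = foldr _⇒_ B Γ

∼ : Fm → Fm
∼ (A ⇒ ⊥') = A
∼ B = ¬' B

evalB : (Fm → Bool) → Fm → Bool
evalB v (var n) = v (var n)
evalB v ⊥' = false
evalB v (A ⇒ B) = not (evalB v A) ∨ evalB v B
evalB v (A ▷ B) = v (A ▷ B)

Tautology : Fm → Set
Tautology A = (v : Fm → Bool) → evalB v A ≡ true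

data Ext : Set where
  M M₀ P P₀ R : Ext

data ExtAx : Ext → Fm → Set where
  axM  : ∀ A B C → ExtAx M  ((A ▷ B) ⇒ ((A ∧' □ C) ▷ (B ∧' □ C)))
  axM₀ : ∀ A B C → ExtAx M₀ ((A ▷ B) ⇒ ((◇ A ∧' □ C) ▷ (B ∧' □ C)))
  axP  : ∀ A B   → ExtAx P  ((A ▷ B) ⇒ □ (A ▷ B))
  axP₀ : ∀ A B   → ExtAx P₀ ((A ▷ ◇ B) ⇒ □ (A ▷ B))
  axR  : ∀ A B C → ExtAx R  ((A ▷ B) ⇒ (¬' (A ▷ ¬' C) ▷ (B ∧' □ C)))

infix 2 _⊢_
data _⊢_ (X : List Ext) : Fm → Set where
  taut : ∀ {A} → Tautology A → X ⊢ A
  axK  : ∀ A B → X ⊢ □ (A ⇒ B) ⇒ (□ A ⇒ □ B)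
  axL  : ∀ A → X ⊢ □ (□ A ⇒ A) ⇒ □ A
  axJ1 : ∀ A B → X ⊢ □ (A ⇒ B) ⇒ (A ▷ B)
  axJ2 : ∀ A B C → X ⊢ ((A ▷ B) ∧' (B ▷ C)) ⇒ (A ▷ C)
  axJ3 : ∀ A B C → X ⊢ ((A ▷ C) ∧' (B ▷ C)) ⇒ ((A ∨' B) ▷ C)
  axJ4 : ∀ A B → X ⊢ (A ▷ B) ⇒ (◇ A ⇒ ◇ B)
  axJ5 : ∀ A → X ⊢ ◇ A ▷ A
  ext  : ∀ {Y A} → Y ∈ X → ExtAx Y A → X ⊢ A
  mp   : ∀ {A B} → X ⊢ A ⇒ B → X ⊢ A → X ⊢ B
  nec  : ∀ {A} → X ⊢ A → X ⊢ □ A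

FmSet : Set₁
FmSet = Fm → Set

_⊆F_ : FmSet → FmSet → Set
Γ ⊆F Δ = ∀ A → Γ A → Δ A

Consistent : List Ext → FmSet → Set
Consistent X Γ = ¬ (Σ (List Fm) λ L → All Γ L × (X ⊢ L ⇒* ⊥'))

MCS : List Ext → FmSet → Set₁
MCS X Γ = Consistent X Γ × ((Δ : FmSet) → Γ ⊆F Δ → Consistent X Δ → Δ ⊆F Γ)

module FrameConditions {a s : Level} {W : Set a}
         (Rel : W → W → Set a) (S : W → W → (W → Set a) → Set s) where

  _⊆_ : (W → Set a) → (W → Set a) → Set a
  V ⊆ Z = ∀ x → V x → Z x

  RImg⊆ : (W → Set a) → W → Set a
  RImg⊆ V u = ∀ v → V v → ∀ y → Rel v y → Rel u y

  RImg⊆Set : (W → Set a) → (W → Set a) → Set a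
  RImg⊆Set V C = ∀ v → V v → ∀ y → Rel v y → C y

  𝒞 : W → W → (W → Set a) → Set (lsuc a ⊔ s)
  𝒞 x u C = (∀ y → C y → Rel x y) ×
            ((Z : W → Set a) → S x u Z → Σ W λ z → Z z × C z)

  Mgen : Set (lsuc a ⊔ s)
  Mgen = ∀ w u (V : W → Set a) → S w u V →
           Σ (W → Set a) λ V' → V' ⊆ V × S w u V' × RImg⊆ V' u

  M₀gen : Set (lsuc a ⊔ s)
  M₀gen = ∀ w u x (V : W → Set a) → Rel w u → Rel u x → S w x V →
           Σ (W → Set a) λ V' → V' ⊆ V × S w u V' × RImg⊆ V' u

  Pgen : Set (lsuc a ⊔ s)
  Pgen = ∀ w w' u (V : W → Set a) → Rel w w' → Rel w' u → S w u V →
           Σ (W → Set a) λ V' → V' ⊆ V × S w' u V'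

  P₀gen : Set (lsuc a ⊔ s)
  P₀gen = ∀ w x u (V Z : W → Set a) → Rel w x → Rel x u → S w u V →
           (∀ v → V v → Σ W λ y → Rel v y × Z y) →
           Σ (W → Set a) λ Z' → Z' ⊆ Z × S x u Z'

  Rgen : Set (lsuc a ⊔ s)
  Rgen = ∀ w x u (V : W → Set a) → Rel w x → Rel x u → S w u V →
           (C : W → Set a) → 𝒞 x u C →
           Σ (W → Set a) λ U → U ⊆ V × S w x U × RImg⊆Set U C

  Cond : Ext → Set (lsuc a ⊔ s)
  Cond M = Mgen
  Cond M₀ = M₀gen
  Cond P = Pgen
  Cond P₀ = P₀gen
  Cond R = Rgen

  SatAll : List Ext → Set (lsuc a ⊔ s)
  SatAll X = ∀ Y → Y ∈ X → Cond Y

record GenFrame : Set₁ where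
  field
    W      : Set
    w₀     : W                                   -- W ≠ ∅
    Rel    : W → W → Set
    S      : W → W → (W → Set) → Set
    R-trans : ∀ {x y z} → Rel x y → Rel y z → Rel x z
    R-cwf  : WellFounded (λ x y → Rel y x)
    S-dom  : ∀ {w u V} → S w u V → Rel w u
    S-cod  : ∀ {w u V} → S w u V → ∀ x → V x → Rel w x
    S-ne   : ∀ {w u V} → S w u V → Σ W λ x → V x
    S-refl : ∀ {w u} → Rel w u → S w u (λ x → x ≡ u)
    S-union : ∀ {w u V} → S w u V →
              (Z : (v : W) → V v → W → Set) →
              (∀ v (p : V v) → S w v (Z v p)) →
              S w u (λ x → Σ W λ v → Σ (V v) λ p → Z v p x)
    S-R    : ∀ {w u v} → Rel w u → Rel u v → S w u (λ x → x ≡ v)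
    S-mono : ∀ {w u V Z} → S w u V → (∀ x → V x → Z x) →
             (∀ x → Z x → Rel w x) → S w u Z

record GenModel : Set₁ where
  field
    frame : GenFrame
  open GenFrame frame public
  field
    val : W → ℕ → Set

  infix 3 _⊩_
  _⊩_ : W → Fm → Set₁
  w ⊩ var n = Lift _ (val w n)
  w ⊩ ⊥' = Lift _ ⊥
  w ⊩ (A ⇒ B) = w ⊩ A → w ⊩ B
  w ⊩ (A ▷ B) = ∀ u → Rel w u → u ⊩ A →
                Σ (W → Set) λ V → S w u V × (∀ v → V v → v ⊩ B)

ModelSat : List Ext → GenModel → Set₁
ModelSat X 𝔐 = FrameConditions.SatAll (GenModel.Rel 𝔐) (GenModel.S 𝔐) X

SubformulaClosed : List Fm → Set
SubformulaClosed D = ∀ {A B} → ((A ⇒ B) ∈ D → A ∈ D × B ∈ D)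
                                × ((A ▷ B) ∈ D → A ∈ D × B ∈ D)

NegClosed : List Fm → Set
NegClosed D = ∀ {B} → B ∈ D → ∼ B ∈ D

module ILXStructure (X : List Ext) (D : List Fm) where

  Prec : FmSet → FmSet → FmSet → Set
  Prec S w u = (S' : List Fm) → All S S' → ∀ A →
               w (A ▷ ⋁ (map ¬' S')) → u (¬' A) × u (□ (¬' A))

  World : Set₁
  World = Σ FmSet λ w → MCS X w × Σ Fm λ G → G ∈ D × w (G ∧' □ (¬' G))

  carrier : World → FmSet
  carrier (w , _) = w

  Rel : World → World → Set₁
  Rel w u = Lift _ (Prec (λ _ → ⊥) (carrier w) (carrier u))

  S : World → World → (World → Set₁) → Set₁
  S w u V = Rel w u × (∀ x → V x → Rel w x) ×
            ((Sf : FmSet) → Prec Sf (carrier w) (carrier u) →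
               Σ World λ v → V v × Prec Sf (carrier w) (carrier v))

  Sat : Set₂
  Sat = FrameConditions.SatAll Rel S X

module Submission where

-- Canonical-model argument, made finite.  If X ⊬ A, let 𝒟 consist of the
-- subformulas of A and ⊥ together with their negations.  By Löb's rule
-- ¬A ∧ □¬¬A is consistent, so by Lindenbaum's lemma it lies in a world w₀ of
-- the ILX-structure for 𝒟.  That structure is a generalized Veltman model:
-- ≺ is conversely well-founded because along ≺ the number of G ∈ 𝒟 with
-- □¬G ∉ w decreases, and the existence lemma (w ∌ E ▷ ⋁¬S' for finite
-- S' ⊆ S gives u ∋ E with w ≺_S u) yields the truth lemma for 𝒟.  Since
-- models live in Set and the ILX-structure in Set₁, worlds are represented
-- by Boolean characteristic functions and the assumed frame conditions are
-- transferred along this representation.  Validity of A then contradicts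
-- ¬A ∈ w₀.  Excluded middle (a hypothesis of the theorem) is used for
-- Lindenbaum's lemma, characteristic functions, and the final case split.

open import Defs
open import Level using (Level; Lift; lift; lower)
open import Axiom.ExcludedMiddle using (ExcludedMiddle)
open import Data.Nat using (ℕ; zero; suc; _+_; _≤_; _<_; _⊔_; z≤n; s≤s; _≤′_; ≤′-refl; ≤′-step)
open import Data.Nat.Properties using (m≤m⊔n; m≤n⊔m; ≤⇒≤′; +-mono-≤; +-mono-<-≤; +-mono-≤-<)
open import Data.Nat.Induction using (<-wellFounded)
open import Data.Bool using (Bool; true; false; not; _∨_; _∧_; T)
open import Data.Bool.Properties using (T-∧; T-≡)
open import Function.Bundles using (Equivalence)
open import Data.Fin using (Fin; zero; suc)
open import Data.Vec using (Vec; []; _∷_; lookup)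
import Data.Vec as Vec
open import Data.Vec.Properties using (lookup-map)
open import Data.Empty using (⊥; ⊥-elim)
open import Data.Product using (Σ; _×_; _,_; proj₁; proj₂; map₂)
import Data.Product as Product
open import Data.Sum using (_⊎_; inj₁; inj₂)
import Data.Sum as Sum
open import Data.List using (List; []; _∷_; _++_; map)
open import Data.List.Relation.Unary.All using (All; []; _∷_)
import Data.List.Relation.Unary.All as All
open import Data.List.Relation.Unary.All.Properties using (++⁺)
open import Data.List.Relation.Unary.Any using (here; there)
open import Data.List.Membership.Propositional using (_∈_)
open import Data.List.Membership.Propositional.Properties using (∈-++⁺ˡ; ∈-++⁺ʳ; ∈-++⁻; ∈-map⁺; ∈-map⁻)
open import Relation.Binary.PropositionalEquality using (_≡_; refl; sym; trans; cong₂)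
open import Relation.Nullary using (¬_; yes; no; does)
open import Relation.Nullary.Decidable using (True; fromWitness; toWitness)
open import Induction.WellFounded using (WellFounded; module Subrelation)
import Relation.Binary.Construct.On as On

-- A
-- skeleton valid in its truth table yields, for every instantiation of its
-- atoms by modal formulas, a classical tautology and hence an axiom of ILX.
-- This is how all purely propositional steps below are justified.
module Skeleton where

  infixr 5 _⟶_
  infixr 6 _∧ₛ_ _∨ₛ_
  infix 7 ¬ₛ_

  data Sk (n : ℕ) : Set where
    atom : Fin n → Sk n
    ⊥ₛ   : Sk n
    _⟶_  : Sk n → Sk n → Sk n

  ¬ₛ_ : ∀ {n} → Sk n → Sk n
  ¬ₛ p = p ⟶ ⊥ₛ

  _∧ₛ_ : ∀ {n} → Sk n → Sk n → Sk n
  p ∧ₛ q = ¬ₛ (p ⟶ ¬ₛ q)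

  _∨ₛ_ : ∀ {n} → Sk n → Sk n → Sk n
  p ∨ₛ q = ¬ₛ p ⟶ q

  p₀ : ∀ {n} → Sk (suc n)
  p₀ = atom zero
  p₁ : ∀ {n} → Sk (suc (suc n))
  p₁ = atom (suc zero)
  p₂ : ∀ {n} → Sk (suc (suc (suc n)))
  p₂ = atom (suc (suc zero))
  p₃ : ∀ {n} → Sk (suc (suc (suc (suc n))))
  p₃ = atom (suc (suc (suc zero)))
  p₄ : ∀ {n} → Sk (suc (suc (suc (suc (suc n)))))
  p₄ = atom (suc (suc (suc (suc zero))))

  ⟦_⟧ : ∀ {n} → Sk n → Vec Bool n → Bool
  ⟦ atom i ⟧ ρ = lookup ρ i
  ⟦ ⊥ₛ ⟧ ρ = false
  ⟦ p ⟶ q ⟧ ρ = not (⟦ p ⟧ ρ) ∨ ⟦ q ⟧ ρ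

  instantiate : ∀ {n} → Vec Fm n → Sk n → Fm
  instantiate σ (atom i) = lookup σ i
  instantiate σ ⊥ₛ = ⊥'
  instantiate σ (p ⟶ q) = instantiate σ p ⇒ instantiate σ q

  evalB-instantiate : ∀ {n} (v : Fm → Bool) (σ : Vec Fm n) p →
                      evalB v (instantiate σ p) ≡ ⟦ p ⟧ (Vec.map (evalB v) σ)
  evalB-instantiate v σ (atom i) = sym (lookup-map i (evalB v) σ)
  evalB-instantiate v σ ⊥ₛ = refl
  evalB-instantiate v σ (p ⟶ q) =
    cong₂ (λ a b → not a ∨ b) (evalB-instantiate v σ p) (evalB-instantiate v σ q)

  everyRow : (n : ℕ) → (Vec Bool n → Bool) → Bool
  everyRow zero f = f []
  everyRow (suc n) f = everyRow n (λ ρ → f (true ∷ ρ)) ∧ everyRow n (λ ρ → f (false ∷ ρ))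

  everyRow-sound : ∀ n f → T (everyRow n f) → ∀ ρ → T (f ρ)
  everyRow-sound zero f t [] = t
  everyRow-sound (suc n) f t (b ∷ ρ) with Equivalence.to (T-∧ {everyRow n (λ ρ → f (true ∷ ρ))}) t
  everyRow-sound (suc n) f t (true ∷ ρ) | t₁ , _ = everyRow-sound n _ t₁ ρ
  everyRow-sound (suc n) f t (false ∷ ρ) | _ , t₂ = everyRow-sound n _ t₂ ρ

  isTautology : ∀ {n} → Sk n → Bool
  isTautology {n} p = everyRow n ⟦ p ⟧

  -- every instance of a truth-table tautology is a theorem; the side
  -- condition is discharged by evaluation when p is a closed skeleton
  tautology : ∀ {X n} (p : Sk n) {_ : T (isTautology p)} (σ : Vec Fm n) →
              X ⊢ instantiate σ p
  tautology {n = n} p {t} σ = taut λ v →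
    trans (evalB-instantiate v σ p)
          (Equivalence.to T-≡ (everyRow-sound n ⟦ p ⟧ t (Vec.map (evalB v) σ)))

open Skeleton using (tautology; ⊥ₛ; _⟶_; ¬ₛ_; _∧ₛ_; _∨ₛ_; p₀; p₁; p₂; p₃; p₄)

module _ {X : List Ext} where

  mp₂ : ∀ {A B C} → X ⊢ A ⇒ B ⇒ C → X ⊢ A → X ⊢ B → X ⊢ C
  mp₂ h a b = mp (mp h a) b

  ⇒-trans : ∀ {A B C} → X ⊢ A ⇒ B → X ⊢ B ⇒ C → X ⊢ A ⇒ C
  ⇒-trans {A} {B} {C} =
    mp₂ (tautology ((p₀ ⟶ p₁) ⟶ (p₁ ⟶ p₂) ⟶ (p₀ ⟶ p₂)) (A ∷ B ∷ C ∷ []))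

  ∧-intro-⇒ : ∀ A B → X ⊢ A ⇒ B ⇒ (A ∧' B)
  ∧-intro-⇒ A B = tautology (p₀ ⟶ p₁ ⟶ (p₀ ∧ₛ p₁)) (A ∷ B ∷ [])

  ∧-intro : ∀ {A B} → X ⊢ A → X ⊢ B → X ⊢ A ∧' B
  ∧-intro {A} {B} = mp₂ (∧-intro-⇒ A B)

  ∧-curry : ∀ {A B C} → X ⊢ (A ∧' B) ⇒ C → X ⊢ A ⇒ B ⇒ C
  ∧-curry {A} {B} {C} = mp (tautology (((p₀ ∧ₛ p₁) ⟶ p₂) ⟶ (p₀ ⟶ p₁ ⟶ p₂)) (A ∷ B ∷ C ∷ []))

  ∧-elimˡ : ∀ A B → X ⊢ (A ∧' B) ⇒ A
  ∧-elimˡ A B = tautology ((p₀ ∧ₛ p₁) ⟶ p₀) (A ∷ B ∷ [])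

  ∧-elimʳ : ∀ A B → X ⊢ (A ∧' B) ⇒ B
  ∧-elimʳ A B = tautology ((p₀ ∧ₛ p₁) ⟶ p₁) (A ∷ B ∷ [])

  □-mono : ∀ {A B} → X ⊢ A ⇒ B → X ⊢ □ A ⇒ □ B
  □-mono {A} {B} h = mp (axK A B) (nec h)

  ⇒-to-▷ : ∀ {A B} → X ⊢ A ⇒ B → X ⊢ A ▷ B
  ⇒-to-▷ {A} {B} h = mp (axJ1 A B) (nec h)

  ▷-trans : ∀ {A B C} → X ⊢ A ▷ B → X ⊢ B ▷ C → X ⊢ A ▷ C
  ▷-trans {A} {B} {C} h k = mp (axJ2 A B C) (∧-intro h k)

  ▷-∨ : ∀ {A B C} → X ⊢ A ▷ C → X ⊢ B ▷ C → X ⊢ (A ∨' B) ▷ C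
  ▷-∨ {A} {B} {C} h k = mp (axJ3 A B C) (∧-intro h k)

  -- E ▷ E ∧ □¬E, the interpretability form of Löb's principle: by Löb,
  -- E implies (E ∧ □¬E) ∨ ◇(E ∧ □¬E), and ◇(E ∧ □¬E) ▷ E ∧ □¬E by J5.
  ▷-löb : ∀ E → X ⊢ E ▷ (E ∧' □ (¬' E))
  ▷-löb E = ▷-trans (⇒-to-▷ E→K∨◇K) (▷-∨ (⇒-to-▷ (tautology (p₀ ⟶ p₀) (K ∷ []))) (axJ5 K))
    where
    K : Fm
    K = E ∧' □ (¬' E)
    □¬K→□¬E : X ⊢ □ (¬' K) ⇒ □ (¬' E)
    □¬K→□¬E = ⇒-trans (□-mono (tautology (¬ₛ (p₀ ∧ₛ p₁) ⟶ (p₁ ⟶ ¬ₛ p₀)) (E ∷ □ (¬' E) ∷ [])))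
                      (axL (¬' E))
    E→K∨◇K : X ⊢ E ⇒ (K ∨' ◇ K)
    E→K∨◇K = mp (tautology ((p₀ ⟶ p₁) ⟶ (p₂ ⟶ ((p₂ ∧ₛ p₁) ∨ₛ ¬ₛ p₀)))
                           (□ (¬' K) ∷ □ (¬' E) ∷ E ∷ [])) □¬K→□¬E

⋀ : List Fm → Fm
⋀ [] = ⊤'
⋀ (G ∷ L) = G ∧' ⋀ L

_∪｛_｝ : FmSet → Fm → FmSet
(Γ ∪｛ A ｝) B = Γ B ⊎ B ≡ A

module _ {X : List Ext} where

  ⇒*-to-⋀ : ∀ L F → X ⊢ (L ⇒* F) ⇒ (⋀ L ⇒ F)
  ⇒*-to-⋀ [] F = tautology (p₀ ⟶ (¬ₛ ⊥ₛ ⟶ p₀)) (F ∷ [])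
  ⇒*-to-⋀ (G ∷ L) F =
    mp (tautology ((p₀ ⟶ (p₁ ⟶ p₂)) ⟶ ((p₃ ⟶ p₀) ⟶ ((p₃ ∧ₛ p₁) ⟶ p₂)))
                  ((L ⇒* F) ∷ ⋀ L ∷ F ∷ G ∷ []))
       (⇒*-to-⋀ L F)

  ⋀-to-⇒* : ∀ L F → X ⊢ (⋀ L ⇒ F) ⇒ (L ⇒* F)
  ⋀-to-⇒* [] F = tautology ((¬ₛ ⊥ₛ ⟶ p₀) ⟶ p₀) (F ∷ [])
  ⋀-to-⇒* (G ∷ L) F =
    mp (tautology (((p₁ ⟶ p₂) ⟶ p₀) ⟶ (((p₃ ∧ₛ p₁) ⟶ p₂) ⟶ (p₃ ⟶ p₀)))
                  ((L ⇒* F) ∷ ⋀ L ∷ F ∷ G ∷ []))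
       (⋀-to-⇒* L F)

  ⋀-++ : ∀ L₁ L₂ → X ⊢ ⋀ (L₁ ++ L₂) ⇒ (⋀ L₁ ∧' ⋀ L₂)
  ⋀-++ [] L₂ = tautology (p₀ ⟶ (¬ₛ ⊥ₛ ∧ₛ p₀)) (⋀ L₂ ∷ [])
  ⋀-++ (G ∷ L₁) L₂ =
    mp (tautology ((p₂ ⟶ (p₀ ∧ₛ p₁)) ⟶ ((p₃ ∧ₛ p₂) ⟶ ((p₃ ∧ₛ p₀) ∧ₛ p₁)))
                  (⋀ L₁ ∷ ⋀ L₂ ∷ ⋀ (L₁ ++ L₂) ∷ G ∷ []))
       (⋀-++ L₁ L₂)

  ⇒*-contrapose : ∀ L B → X ⊢ (L ⇒* B) ⇒ ((L ++ ¬' B ∷ []) ⇒* ⊥')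
  ⇒*-contrapose [] B = tautology (p₀ ⟶ ¬ₛ p₀ ⟶ ⊥ₛ) (B ∷ [])
  ⇒*-contrapose (G ∷ L) B =
    mp (tautology ((p₀ ⟶ p₁) ⟶ ((p₂ ⟶ p₀) ⟶ (p₂ ⟶ p₁)))
                  ((L ⇒* B) ∷ ((L ++ ¬' B ∷ []) ⇒* ⊥') ∷ G ∷ []))
       (⇒*-contrapose L B)

  ⋀-∪ : ∀ {Γ A} L → All (Γ ∪｛ A ｝) L →
        Σ (List Fm) λ L' → All Γ L' × (X ⊢ (⋀ L' ∧' A) ⇒ ⋀ L)
  ⋀-∪ {A = A} [] [] = [] , [] , tautology (p₀ ⟶ ¬ₛ ⊥ₛ) ((⊤' ∧' A) ∷ [])
  ⋀-∪ {A = A} (G ∷ L) (inj₂ refl ∷ ps) with ⋀-∪ L ps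
  ... | L' , qs , h =
    L' , qs , mp (tautology (((p₀ ∧ₛ p₁) ⟶ p₂) ⟶ ((p₀ ∧ₛ p₁) ⟶ (p₁ ∧ₛ p₂)))
                            (⋀ L' ∷ A ∷ ⋀ L ∷ [])) h
  ⋀-∪ {A = A} (G ∷ L) (inj₁ g ∷ ps) with ⋀-∪ L ps
  ... | L' , qs , h =
    G ∷ L' , g ∷ qs , mp (tautology (((p₀ ∧ₛ p₁) ⟶ p₂) ⟶ (((p₃ ∧ₛ p₀) ∧ₛ p₁) ⟶ (p₃ ∧ₛ p₂)))
                                    (⋀ L' ∷ A ∷ ⋀ L ∷ G ∷ [])) h

module Theories (X : List Ext) where

  Cons : FmSet → Set
  Cons = Consistent X

  Complete : FmSet → Set
  Complete Γ = ∀ A → Γ A ⊎ Γ (¬' A)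

  cons-⋀ : ∀ {Γ} → Cons Γ → ∀ L → All Γ L → X ⊢ ⋀ L ⇒ ⊥' → ⊥
  cons-⋀ c L ps h = c (L , ps , mp (⋀-to-⇒* L ⊥') h)

  cons-⊆ : ∀ {Γ Δ : FmSet} → Γ ⊆F Δ → Cons Δ → Cons Γ
  cons-⊆ s c (L , ps , h) = c (L , All.map (λ {x} → s x) ps , h)

  module Closure {Γ : FmSet} (c : Cons Γ) (k : Complete Γ) where

    not-both : ∀ {A} → Γ A → Γ (¬' A) → ⊥
    not-both {A} a na = c (A ∷ ¬' A ∷ [] , a ∷ na ∷ [] , tautology (p₀ ⟶ ¬ₛ p₀ ⟶ ⊥ₛ) (A ∷ []))

    ∋-derivable : ∀ {B} L → All Γ L → X ⊢ L ⇒* B → Γ B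
    ∋-derivable {B} L ps h with k B
    ... | inj₁ b = b
    ... | inj₂ nb = ⊥-elim (c (L ++ ¬' B ∷ [] , ++⁺ ps (nb ∷ []) , mp (⇒*-contrapose L B) h))

    ∋-theorem : ∀ {A} → X ⊢ A → Γ A
    ∋-theorem = ∋-derivable [] []

    ∋-⇒ : ∀ {A B} → X ⊢ A ⇒ B → Γ A → Γ B
    ∋-⇒ h a = ∋-derivable (_ ∷ []) (a ∷ []) h

    ∋-⇒₂ : ∀ {A B C} → X ⊢ A ⇒ B ⇒ C → Γ A → Γ B → Γ C
    ∋-⇒₂ h a b = ∋-derivable (_ ∷ _ ∷ []) (a ∷ b ∷ []) h

    ∋-mp : ∀ {A B} → Γ (A ⇒ B) → Γ A → Γ B
    ∋-mp {A} {B} = ∋-⇒₂ (tautology ((p₀ ⟶ p₁) ⟶ p₀ ⟶ p₁) (A ∷ B ∷ []))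

  complete-maximal : ∀ {Γ} → Cons Γ → Complete Γ → MCS X Γ
  complete-maximal {Γ} c k = c , maximal
    where
    maximal : (Δ : FmSet) → Γ ⊆F Δ → Cons Δ → Δ ⊆F Γ
    maximal Δ sub cΔ A a with k A
    ... | inj₁ x = x
    ... | inj₂ na = ⊥-elim (cΔ (A ∷ ¬' A ∷ [] , a ∷ sub _ na ∷ [] , tautology (p₀ ⟶ ¬ₛ p₀ ⟶ ⊥ₛ) (A ∷ [])))

  module Classical (lem : ∀ {ℓ} → ExcludedMiddle ℓ) where

    inconsistency-witness : ∀ {Δ} → ¬ Cons Δ → Σ (List Fm) λ L → All Δ L × (X ⊢ L ⇒* ⊥')
    inconsistency-witness {Δ} nc with lem {P = Σ (List Fm) λ L → All Δ L × (X ⊢ L ⇒* ⊥')}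
    ... | yes p = p
    ... | no q = ⊥-elim (nc q)

    extend-A-or-¬A : ∀ {Γ A} → Cons Γ → ¬ Cons (Γ ∪｛ A ｝) → ¬ Cons (Γ ∪｛ ¬' A ｝) → ⊥
    extend-A-or-¬A {Γ} {A} c n₁ n₂
      with inconsistency-witness n₁ | inconsistency-witness n₂
    ... | L₁ , ps₁ , h₁ | L₂ , ps₂ , h₂ with ⋀-∪ L₁ ps₁ | ⋀-∪ L₂ ps₂
    ... | L₁' , qs₁ , g₁ | L₂' , qs₂ , g₂ =
      cons-⋀ c (L₁' ++ L₂') (++⁺ qs₁ qs₂) (⇒-trans (⋀-++ L₁' L₂') refuted)
      where
      -- both ⋀L₁' ∧ A and ⋀L₂' ∧ ¬A are refutable, hence so is ⋀L₁' ∧ ⋀L₂'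
      refuted : X ⊢ ¬' (⋀ L₁' ∧' ⋀ L₂')
      refuted = mp (mp (mp (mp (tautology (((p₀ ∧ₛ p₁) ⟶ p₂) ⟶ (p₂ ⟶ ⊥ₛ) ⟶ ((p₃ ∧ₛ ¬ₛ p₁) ⟶ p₄)
                                           ⟶ (p₄ ⟶ ⊥ₛ) ⟶ ¬ₛ (p₀ ∧ₛ p₃))
                                          (⋀ L₁' ∷ A ∷ ⋀ L₁ ∷ ⋀ L₂' ∷ ⋀ L₂ ∷ []))
                             g₁) (mp (⇒*-to-⋀ L₁ ⊥') h₁)) g₂) (mp (⇒*-to-⋀ L₂ ⊥') h₂)

module Enumeration where

  combineWith : Fm → List Fm → List Fm
  combineWith a [] = []
  combineWith a (b ∷ m) = (a ⇒ b) ∷ (a ▷ b) ∷ combineWith a m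

  combine : List Fm → List Fm → List Fm
  combine [] m = []
  combine (a ∷ l) m = combineWith a m ++ combine l m

  ∈-combineWith : ∀ {a b m} → b ∈ m → ((a ⇒ b) ∈ combineWith a m) × ((a ▷ b) ∈ combineWith a m)
  ∈-combineWith (here refl) = here refl , there (here refl)
  ∈-combineWith (there h) with ∈-combineWith h
  ... | p , q = there (there p) , there (there q)

  ∈-combine : ∀ {a b l m} → a ∈ l → b ∈ m → ((a ⇒ b) ∈ combine l m) × ((a ▷ b) ∈ combine l m)
  ∈-combine {m = m} (here refl) hb with ∈-combineWith {m = m} hb
  ... | p , q = ∈-++⁺ˡ p , ∈-++⁺ˡ q
  ∈-combine {l = a' ∷ l} {m = m} (there ha) hb with ∈-combine ha hb
  ... | p , q = ∈-++⁺ʳ (combineWith a' m) p , ∈-++⁺ʳ (combineWith a' m) q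

  formulas : ℕ → List Fm
  formulas zero = []
  formulas (suc n) = ⊥' ∷ var n ∷ combine (formulas n) (formulas n) ++ formulas n

  formulas-mono : ∀ {n m A} → n ≤ m → A ∈ formulas n → A ∈ formulas m
  formulas-mono le = go (≤⇒≤′ le)
    where
    go : ∀ {n m A} → n ≤′ m → A ∈ formulas n → A ∈ formulas m
    go ≤′-refl h = h
    go {m = suc m} (≤′-step le) h = there (there (∈-++⁺ʳ (combine (formulas m) (formulas m)) (go le h)))

  formulas-cover : ∀ A → Σ ℕ λ n → A ∈ formulas n
  formulas-cover (var k) = suc k , there (here refl)
  formulas-cover ⊥' = 1 , here refl
  formulas-cover (A ⇒ B) with formulas-cover A | formulas-cover B
  ... | n₁ , h₁ | n₂ , h₂ =
    suc (n₁ ⊔ n₂) , there (there (∈-++⁺ˡ (proj₁ (∈-combine (formulas-mono (m≤m⊔n n₁ n₂) h₁)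
                                                             (formulas-mono (m≤n⊔m n₁ n₂) h₂)))))
  formulas-cover (A ▷ B) with formulas-cover A | formulas-cover B
  ... | n₁ , h₁ | n₂ , h₂ =
    suc (n₁ ⊔ n₂) , there (there (∈-++⁺ˡ (proj₂ (∈-combine (formulas-mono (m≤m⊔n n₁ n₂) h₁)
                                                             (formulas-mono (m≤n⊔m n₁ n₂) h₂)))))

-- Formulas are added one by one along the enumeration whenever this
-- preserves consistency; the union of the resulting chain is maximal.
module Lindenbaum (X : List Ext) (lem : ∀ {ℓ} → ExcludedMiddle ℓ) where
  open Enumeration
  open Theories X
  open Classical lem

  add : Fm → FmSet → FmSet
  add A Δ B = Δ B ⊎ (B ≡ A × Cons (Δ ∪｛ A ｝))

  add-cons : ∀ {A Δ} → Cons Δ → Cons (add A Δ)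
  add-cons {A} {Δ} c with lem {P = Cons (Δ ∪｛ A ｝)}
  ... | yes ci = cons-⊆ (λ { B (inj₁ x) → inj₁ x ; B (inj₂ (e , _)) → inj₂ e }) ci
  ... | no nci = cons-⊆ (λ { B (inj₁ x) → x ; B (inj₂ (_ , ci)) → ⊥-elim (nci ci) }) c

  add-decides : ∀ A Δ → add A Δ A ⊎ ¬ Cons (Δ ∪｛ A ｝)
  add-decides A Δ with lem {P = Cons (Δ ∪｛ A ｝)}
  ... | yes ci = inj₁ (inj₂ (refl , ci))
  ... | no nci = inj₂ nci

  addAll : List Fm → FmSet → FmSet
  addAll [] Δ = Δ
  addAll (a ∷ l) Δ = addAll l (add a Δ)

  addAll-⊇ : ∀ l {Δ} → Δ ⊆F addAll l Δ
  addAll-⊇ [] _ x = x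
  addAll-⊇ (a ∷ l) B x = addAll-⊇ l B (inj₁ x)

  addAll-cons : ∀ l {Δ} → Cons Δ → Cons (addAll l Δ)
  addAll-cons [] c = c
  addAll-cons (a ∷ l) c = addAll-cons l (add-cons c)

  addAll-decides : ∀ l Δ {A} → A ∈ l →
                   addAll l Δ A ⊎ Σ FmSet λ Δ' → (Δ' ⊆F addAll l Δ) × ¬ Cons (Δ' ∪｛ A ｝)
  addAll-decides (a ∷ l) Δ (here refl) with add-decides a Δ
  ... | inj₁ x = inj₁ (addAll-⊇ l a x)
  ... | inj₂ n = inj₂ (Δ , (λ B x → addAll-⊇ l B (inj₁ x)) , n)
  addAll-decides (a ∷ l) Δ (there h) = addAll-decides l (add a Δ) h

  chain : FmSet → ℕ → FmSet
  chain Γ zero = Γ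
  chain Γ (suc n) = addAll (formulas n) (chain Γ n)

  chain-mono : ∀ {Γ n m} → n ≤ m → chain Γ n ⊆F chain Γ m
  chain-mono le = go (≤⇒≤′ le)
    where
    go : ∀ {Γ n m} → n ≤′ m → chain Γ n ⊆F chain Γ m
    go ≤′-refl B x = x
    go {m = suc m} (≤′-step le) B x = addAll-⊇ (formulas m) B (go le B x)

  chain-cons : ∀ {Γ} n → Cons Γ → Cons (chain Γ n)
  chain-cons zero c = c
  chain-cons (suc n) c = addAll-cons (formulas n) (chain-cons n c)

  limit : FmSet → FmSet
  limit Γ B = Σ ℕ λ n → chain Γ n B

  limit-finite : ∀ {Γ} L → All (limit Γ) L → Σ ℕ λ n → All (chain Γ n) L
  limit-finite [] [] = 0 , []
  limit-finite (G ∷ L) ((k , g) ∷ ps) with limit-finite L ps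
  ... | n , qs = k ⊔ n , chain-mono (m≤m⊔n k n) G g ∷ All.map (λ {x} → chain-mono (m≤n⊔m k n) x) qs

  limit-cons : ∀ {Γ} → Cons Γ → Cons (limit Γ)
  limit-cons c (L , ps , h) with limit-finite L ps
  ... | n , qs = chain-cons n c (L , qs , h)

  limit-maximal : ∀ {Γ} → (Δ : FmSet) → limit Γ ⊆F Δ → Cons Δ → Δ ⊆F limit Γ
  limit-maximal {Γ} Δ sub cΔ A a with formulas-cover A
  ... | n , h with addAll-decides (formulas n) (chain Γ n) h
  ... | inj₁ x = suc n , x
  ... | inj₂ (Δ' , s , nc) =
    ⊥-elim (nc (cons-⊆ (λ { B (inj₁ x) → sub B (suc n , s B x) ; B (inj₂ refl) → a }) cΔ))

  mcs-complete : ∀ {Γ} → MCS X Γ → Complete Γ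
  mcs-complete {Γ} (c , mx) A with lem {P = Γ A} | lem {P = Γ (¬' A)}
  ... | yes a | _ = inj₁ a
  ... | no _ | yes na = inj₂ na
  ... | no n₁ | no n₂ =
    ⊥-elim (extend-A-or-¬A c (λ ci → n₁ (mx (Γ ∪｛ A ｝) (λ _ → inj₁) ci A (inj₂ refl)))
                             (λ ci → n₂ (mx (Γ ∪｛ ¬' A ｝) (λ _ → inj₁) ci (¬' A) (inj₂ refl))))

  lindenbaum : ∀ {Γ} → Cons Γ → Σ FmSet λ Δ → (Γ ⊆F Δ) × Cons Δ × Complete Δ
  lindenbaum c = limit _ , (λ B x → 0 , x) , limit-cons c , mcs-complete (limit-cons c , limit-maximal)

⋁¬-++ : ∀ {X} S₁ S₂ → X ⊢ (⋁ (map ¬' S₁) ∨' ⋁ (map ¬' S₂)) ⇒ ⋁ (map ¬' (S₁ ++ S₂))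
⋁¬-++ [] S₂ = tautology ((¬ₛ ⊥ₛ ⟶ p₀) ⟶ p₀) (⋁ (map ¬' S₂) ∷ [])
⋁¬-++ (x ∷ S₁) S₂ =
  mp (tautology (((p₀ ∨ₛ p₁) ⟶ p₂) ⟶ (((p₃ ∨ₛ p₀) ∨ₛ p₁) ⟶ (p₃ ∨ₛ p₂)))
                (⋁ (map ¬' S₁) ∷ ⋁ (map ¬' S₂) ∷ ⋁ (map ¬' (S₁ ++ S₂)) ∷ ¬' x ∷ []))
     (⋁¬-++ S₁ S₂)

-- The ILX-structure for 𝒟 with worlds in Set: a world is the Boolean
-- characteristic function of a complete consistent set containing some
-- G ∧ □¬G with G ∈ 𝒟.  Excluded middle makes every formula set expressible
-- in this way.
module BooleanStructure (X : List Ext) (lem : ∀ {ℓ} → ExcludedMiddle ℓ) (D : List Fm) where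
  open Theories X
  open Lindenbaum X lem
  open ILXStructure X D using (Prec)

  holds : (Fm → Bool) → FmSet
  holds b A = b A ≡ true

  record BWorld : Set where
    constructor bworld
    field
      χ          : Fm → Bool
      consistent : Cons (holds χ)
      complete   : Complete (holds χ)
      last       : Fm
      last∈D     : last ∈ D
      holds-last : holds χ (last ∧' □ (¬' last))
  open BWorld public

  ⌊_⌋ : BWorld → FmSet
  ⌊ w ⌋ = holds (χ w)

  module World (w : BWorld) = Closure {⌊ w ⌋} (consistent w) (complete w)

  _≺_ : BWorld → BWorld → Set
  w ≺ u = Prec (λ _ → ⊥) ⌊ w ⌋ ⌊ u ⌋

  toBool : FmSet → Fm → Bool
  toBool Γ A = does (lem {P = Γ A})

  toBool-complete : ∀ Γ A → Γ A → holds (toBool Γ) A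
  toBool-complete Γ A x with lem {P = Γ A}
  ... | yes _ = refl
  ... | no n = ⊥-elim (n x)

  toBool-sound : ∀ Γ A → holds (toBool Γ) A → Γ A
  toBool-sound Γ A x with lem {P = Γ A}
  ... | yes p = p
  ... | no n with x
  ... | ()

  fromSet : (Γ : FmSet) → Cons Γ → Complete Γ → ∀ G → G ∈ D → Γ (G ∧' □ (¬' G)) → BWorld
  fromSet Γ cΓ kΓ G gD g =
    bworld (toBool Γ) (cons-⊆ (toBool-sound Γ) cΓ)
           (λ A → Sum.map (toBool-complete Γ A) (toBool-complete Γ (¬' A)) (kΓ A))
           G gD (toBool-complete Γ _ g)

  ▷-transᵂ : ∀ w {A B C} → ⌊ w ⌋ (A ▷ B) → ⌊ w ⌋ (B ▷ C) → ⌊ w ⌋ (A ▷ C)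
  ▷-transᵂ w {A} {B} {C} = World.∋-⇒₂ w (∧-curry (axJ2 A B C))

  ▷-∨ᵂ : ∀ w {A B C} → ⌊ w ⌋ (A ▷ C) → ⌊ w ⌋ (B ▷ C) → ⌊ w ⌋ ((A ∨' B) ▷ C)
  ▷-∨ᵂ w {A} {B} {C} = World.∋-⇒₂ w (∧-curry (axJ3 A B C))

  ⇒-to-▷ᵂ : ∀ w {A B} → X ⊢ A ⇒ B → ⌊ w ⌋ (A ▷ B)
  ⇒-to-▷ᵂ w h = World.∋-theorem w (⇒-to-▷ h)

  ▷-∨-∨ᵂ : ∀ w {A B C E} → ⌊ w ⌋ (A ▷ C) → ⌊ w ⌋ (B ▷ E) → ⌊ w ⌋ ((A ∨' B) ▷ (C ∨' E))
  ▷-∨-∨ᵂ w {A} {B} {C} {E} h k =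
    ▷-∨ᵂ w (▷-transᵂ w h (⇒-to-▷ᵂ w (tautology (p₀ ⟶ (p₀ ∨ₛ p₁)) (C ∷ E ∷ []))))
           (▷-transᵂ w k (⇒-to-▷ᵂ w (tautology (p₁ ⟶ (p₀ ∨ₛ p₁)) (C ∷ E ∷ []))))

  Prec-antitone : ∀ {S S' w u} → (∀ A → S' A → S A) → Prec S w u → Prec S' w u
  Prec-antitone s p S'' as A h = p S'' (All.map (λ {x} → s x) as) A h

  Prec-≺ : ∀ {S w u} → Prec S ⌊ w ⌋ ⌊ u ⌋ → w ≺ u
  Prec-≺ {S} {w} {u} = Prec-antitone {S} {λ _ → ⊥} {⌊ w ⌋} {⌊ u ⌋} (λ _ ())

  ≺-□ : ∀ {w u C} → w ≺ u → ⌊ w ⌋ (□ C) → ⌊ u ⌋ C × ⌊ u ⌋ (□ C)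
  ≺-□ {w} {u} {C} r h with r [] [] (¬' C) h
  ... | x , y = World.∋-⇒ u (tautology (¬ₛ ¬ₛ p₀ ⟶ p₀) (C ∷ [])) x ,
                World.∋-⇒ u (□-mono (tautology (¬ₛ ¬ₛ p₀ ⟶ p₀) (C ∷ []))) y

  Prec-≺-trans : ∀ {S w u v} → Prec S ⌊ w ⌋ ⌊ u ⌋ → u ≺ v → Prec S ⌊ w ⌋ ⌊ v ⌋
  Prec-≺-trans {S} {w} {u} {v} p r S' as A h = ≺-□ {u} {v} r (proj₂ (p S' as A h))

  -- The world u is
  -- a maximal extension of {E, □¬E} ∪ {¬C, □¬C : w ∋ C ▷ ⋁¬S', S' ⊆ S}.
  module Existence (w : BWorld) (S : FmSet) (E : Fm) (E∈D : E ∈ D)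
                   (no▷ : ∀ S' → All S S' → ¬ ⌊ w ⌋ (E ▷ ⋁ (map ¬' S'))) where

    K : Fm
    K = E ∧' □ (¬' E)

    seed : FmSet
    seed F = F ≡ E ⊎ F ≡ □ (¬' E) ⊎
             Σ Fm λ C → Σ (List Fm) λ S' → All S S' × ⌊ w ⌋ (C ▷ ⋁ (map ¬' S')) ×
               (F ≡ ¬' C ⊎ F ≡ □ (¬' C))

    -- K ∧ ¬⋀L interprets a disjunction ⋁¬S'' for any finite L ⊆ seed: for
    -- the members E and □¬E of the seed this is immediate from K, and a
    -- member ¬C or □¬C contributes (via J5 in the latter case) C ▷ ⋁¬S'
    seed-▷ : ∀ L → All seed L →
             Σ (List Fm) λ S'' → All S S'' × ⌊ w ⌋ ((K ∧' ¬' (⋀ L)) ▷ ⋁ (map ¬' S''))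
    seed-▷ [] [] = [] , [] , ⇒-to-▷ᵂ w (tautology ((p₀ ∧ₛ ¬ₛ ¬ₛ ⊥ₛ) ⟶ ⊥ₛ) (K ∷ []))
    seed-▷ (G ∷ L) (g ∷ ps) with seed-▷ L ps
    ... | S₁ , as₁ , h₁ with g
    ... | inj₁ refl =
      S₁ , as₁ ,
      ▷-transᵂ w (⇒-to-▷ᵂ w (tautology (((p₀ ∧ₛ p₁) ∧ₛ ¬ₛ (p₀ ∧ₛ p₂)) ⟶ ((p₀ ∧ₛ p₁) ∧ₛ ¬ₛ p₂))
                                       (E ∷ □ (¬' E) ∷ ⋀ L ∷ [])))
                 h₁
    ... | inj₂ (inj₁ refl) =
      S₁ , as₁ ,
      ▷-transᵂ w (⇒-to-▷ᵂ w (tautology (((p₀ ∧ₛ p₁) ∧ₛ ¬ₛ (p₁ ∧ₛ p₂)) ⟶ ((p₀ ∧ₛ p₁) ∧ₛ ¬ₛ p₂))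
                                       (E ∷ □ (¬' E) ∷ ⋀ L ∷ [])))
                 h₁
    ... | inj₂ (inj₂ (C , S₂ , as₂ , hC , inj₁ refl)) =
      S₁ ++ S₂ , ++⁺ as₁ as₂ ,
      ▷-transᵂ w (⇒-to-▷ᵂ w (tautology ((p₀ ∧ₛ ¬ₛ (¬ₛ p₁ ∧ₛ p₂)) ⟶ ((p₀ ∧ₛ ¬ₛ p₂) ∨ₛ p₁))
                                       (K ∷ C ∷ ⋀ L ∷ [])))
        (▷-transᵂ w (▷-∨-∨ᵂ w h₁ hC) (⇒-to-▷ᵂ w (⋁¬-++ S₁ S₂)))
    ... | inj₂ (inj₂ (C , S₂ , as₂ , hC , inj₂ refl)) =
      S₁ ++ S₂ , ++⁺ as₁ as₂ ,
      ▷-transᵂ w (⇒-to-▷ᵂ w (tautology ((p₀ ∧ₛ ¬ₛ (p₁ ∧ₛ p₂)) ⟶ ((p₀ ∧ₛ ¬ₛ p₂) ∨ₛ ¬ₛ p₁))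
                                       (K ∷ □ (¬' C) ∷ ⋀ L ∷ [])))
        (▷-transᵂ w (▷-∨-∨ᵂ w h₁ (▷-transᵂ w (World.∋-theorem w (axJ5 C)) hC))
                    (⇒-to-▷ᵂ w (⋁¬-++ S₁ S₂)))

    -- were the seed inconsistent, E ▷ K ▷ K ∧ ¬⋀L ▷ ⋁¬S'' would hold in w
    seed-cons : Cons seed
    seed-cons (L , ps , h) with seed-▷ L ps
    ... | S'' , as , h' =
      no▷ S'' as (▷-transᵂ w (World.∋-theorem w (▷-löb E)) (▷-transᵂ w (⇒-to-▷ᵂ w K→K∧¬⋀L) h'))
      where
      K→K∧¬⋀L : X ⊢ K ⇒ (K ∧' ¬' (⋀ L))
      K→K∧¬⋀L = mp (tautology (¬ₛ p₁ ⟶ (p₀ ⟶ (p₀ ∧ₛ ¬ₛ p₁))) (K ∷ ⋀ L ∷ [])) (mp (⇒*-to-⋀ L ⊥') h)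

    witness : Σ BWorld λ u → Prec S ⌊ w ⌋ ⌊ u ⌋ × ⌊ u ⌋ E
    witness with lindenbaum seed-cons
    ... | Δ , sub , cΔ , kΔ = u , w≺u , toBool-complete Δ E (sub E (inj₁ refl))
      where
      Δ∋K : Δ K
      Δ∋K = Closure.∋-⇒₂ cΔ kΔ (∧-intro-⇒ E (□ (¬' E))) (sub E (inj₁ refl)) (sub _ (inj₂ (inj₁ refl)))
      u : BWorld
      u = fromSet Δ cΔ kΔ E E∈D Δ∋K
      w≺u : Prec S ⌊ w ⌋ ⌊ u ⌋
      w≺u S' as A h = toBool-complete Δ _ (sub _ (inj₂ (inj₂ (A , S' , as , h , inj₁ refl)))) ,
                      toBool-complete Δ _ (sub _ (inj₂ (inj₂ (A , S' , as , h , inj₂ refl))))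

  -- the relation S of the structure, quantifying over Boolean sets S only
  Sᵇ : BWorld → BWorld → (BWorld → Set) → Set
  Sᵇ w u V = w ≺ u × (∀ x → V x → w ≺ x) ×
             ((b : Fm → Bool) → Prec (holds b) ⌊ w ⌋ ⌊ u ⌋ →
                Σ BWorld λ v → V v × Prec (holds b) ⌊ w ⌋ ⌊ v ⌋)

-- ≺ is conversely well-founded: along w ≺ u the number of G ∈ 𝒟 with
-- □¬G ∉ w strictly decreases, since boxes are inherited and the G with
-- G ∧ □¬G ∈ u has □¬G ∉ w.
module ConverseWellFounded (X : List Ext) (lem : ∀ {ℓ} → ExcludedMiddle ℓ) (D : List Fm) where
  open BooleanStructure X lem D

  unboxed : BWorld → Fm → ℕ
  unboxed w G with χ w (□ (¬' G))
  ... | true = 0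
  ... | false = 1

  height : List Fm → BWorld → ℕ
  height [] w = 0
  height (G ∷ l) w = unboxed w G + height l w

  unboxed-≤ : ∀ {w u} G → w ≺ u → unboxed u G ≤ unboxed w G
  unboxed-≤ {w} {u} G r with χ w (□ (¬' G)) in ew
  ... | true with χ u (□ (¬' G)) in eu
  ...   | true = z≤n
  ...   | false with trans (sym eu) (proj₂ (≺-□ {w} {u} r ew))
  ...     | ()
  unboxed-≤ {w} {u} G r | false with χ u (□ (¬' G))
  ... | true = z≤n
  ... | false = s≤s z≤n

  -- last u is boxed in u (as last u ∧ □¬(last u) ∈ u) but not in w (as last u ∈ u)
  unboxed-< : ∀ {w u} → w ≺ u → unboxed u (last u) < unboxed w (last u)
  unboxed-< {w} {u} r with χ u (□ (¬' (last u))) in eu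
  ... | false with trans (sym eu) (World.∋-⇒ u (∧-elimʳ (last u) _) (holds-last u))
  ...   | ()
  unboxed-< {w} {u} r | true with χ w (□ (¬' (last u))) in ew
  ... | false = s≤s z≤n
  ... | true = ⊥-elim (World.not-both u (World.∋-⇒ u (∧-elimˡ (last u) _) (holds-last u))
                                        (proj₁ (≺-□ {w} {u} r ew)))

  height-< : ∀ {w u} l → (∀ G → unboxed u G ≤ unboxed w G) →
             ∀ {G₀} → G₀ ∈ l → unboxed u G₀ < unboxed w G₀ → height l u < height l w
  height-< {w} {u} (G ∷ l) le (here refl) lt = +-mono-<-≤ lt (height-≤ l)
    where
    height-≤ : ∀ l → height l u ≤ height l w
    height-≤ [] = z≤n
    height-≤ (G ∷ l) = +-mono-≤ (le G) (height-≤ l)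
  height-< (G ∷ l) le (there h) lt = +-mono-≤-< (le G) (height-< l le h lt)

  ≺-height : ∀ {w u} → w ≺ u → height D u < height D w
  ≺-height {w} {u} r = height-< {w} {u} D (λ G → unboxed-≤ {w} {u} G r) (last∈D u) (unboxed-< {w} {u} r)

  ≺-converse-wf : WellFounded (λ x y → y ≺ x)
  ≺-converse-wf =
    Subrelation.wellFounded (λ {x} {y} → ≺-height {y} {x}) (On.wellFounded (height D) <-wellFounded)

-- Non-emptiness of
-- S-successor sets uses S = ∅, for which ≺_S is ≺; conditions (c) and (d)
-- use that ≺_S followed by ≺ is ≺_S.
module CanonicalModel (X : List Ext) (lem : ∀ {ℓ} → ExcludedMiddle ℓ) (D : List Fm) where
  open BooleanStructure X lem D
  open ConverseWellFounded X lem D using (≺-converse-wf)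

  frame : BWorld → GenFrame
  frame w₀ = record
    { W = BWorld
    ; w₀ = w₀
    ; Rel = _≺_
    ; S = Sᵇ
    ; R-trans = λ {x} {y} {z} r₁ r₂ → Prec-≺-trans {λ _ → ⊥} {x} {y} {z} r₁ r₂
    ; R-cwf = ≺-converse-wf
    ; S-dom = proj₁
    ; S-cod = λ s → proj₁ (proj₂ s)
    ; S-ne = λ {w} {u} s →
        map₂ proj₁ (proj₂ (proj₂ s) (λ _ → false)
                          (Prec-antitone {λ _ → ⊥} {holds (λ _ → false)} {⌊ w ⌋} {⌊ u ⌋} (λ _ ()) (proj₁ s)))
    ; S-refl = λ {w} {u} r → r , (λ { x refl → r }) , (λ b p → u , refl , p)
    ; S-union = λ {w} {u} {V} s Z f → proj₁ s ,
         (λ { x (v , p , z) → proj₁ (proj₂ (f v p)) x z }) ,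
         (λ b p → let (v , v∈V , pv) = proj₂ (proj₂ s) b p
                      (z , z∈Z , pz) = proj₂ (proj₂ (f v v∈V)) b pv
                  in z , (v , v∈V , z∈Z) , pz)
    ; S-R = λ {w} {u} {v} r₁ r₂ → r₁ , (λ { x refl → Prec-≺-trans {λ _ → ⊥} {w} {u} {v} r₁ r₂ }) ,
                        (λ b p → v , refl , Prec-≺-trans {holds b} {w} {u} {v} p r₂)
    ; S-mono = λ s sub rz → proj₁ s , rz ,
                 (λ b p → let (v , v∈V , pv) = proj₂ (proj₂ s) b p in v , sub v v∈V , pv)
    }

  model : BWorld → GenModel
  model w₀ = record { frame = frame w₀ ; val = λ w n → ⌊ w ⌋ (var n) }

⋁¬¬-copies : ∀ {X} B S' → All (λ F → F ≡ ¬' B) S' → X ⊢ ⋁ (map ¬' S') ⇒ B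
⋁¬¬-copies B [] [] = tautology (⊥ₛ ⟶ p₀) (B ∷ [])
⋁¬¬-copies B (x ∷ S') (refl ∷ as) =
  mp (tautology ((p₁ ⟶ p₀) ⟶ ((¬ₛ ¬ₛ ¬ₛ p₀ ⟶ p₁) ⟶ p₀)) (B ∷ ⋁ (map ¬' S') ∷ []))
     (⋁¬¬-copies B S' as)

module TruthLemma (X : List Ext) (lem : ∀ {ℓ} → ExcludedMiddle ℓ) (D : List Fm)
                  (sc : SubformulaClosed D) (w₀ : BooleanStructure.BWorld X lem D) where
  open BooleanStructure X lem D
  open CanonicalModel X lem D using (model)
  open GenModel (model w₀) using (_⊩_)

  TruthFor : Fm → Set₁
  TruthFor A = ∀ w → (w ⊩ A → ⌊ w ⌋ A) × (⌊ w ⌋ A → w ⊩ A)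

  truth-⇒ : ∀ {A B} → TruthFor A → TruthFor B → TruthFor (A ⇒ B)
  truth-⇒ {A} {B} IA IB w = forced→member , member→forced
    where
    forced→member : (w ⊩ A → w ⊩ B) → ⌊ w ⌋ (A ⇒ B)
    forced→member f with complete w A
    ... | inj₁ a =
      World.∋-⇒ w (tautology (p₁ ⟶ (p₀ ⟶ p₁)) (A ∷ B ∷ [])) (proj₁ (IB w) (f (proj₂ (IA w) a)))
    ... | inj₂ na = World.∋-⇒ w (tautology (¬ₛ p₀ ⟶ (p₀ ⟶ p₁)) (A ∷ B ∷ [])) na
    member→forced : ⌊ w ⌋ (A ⇒ B) → w ⊩ A → w ⊩ B
    member→forced h fa = proj₂ (IB w) (World.∋-mp w h (proj₁ (IA w) fa))

  -- A ▷ B ∈ w is witnessed, for u ⊩ A with w ≺ u, by the set of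
  -- ≺-successors of w containing B: if w ≺_S u, then w ∌ B ▷ ⋁¬S' (else
  -- w ∋ A ▷ ⋁¬S' and ¬A ∈ u), so the existence lemma gives v ∋ B, w ≺_S v
  truth-▷-member : ∀ {A B} → B ∈ D → TruthFor A → TruthFor B → ∀ w → ⌊ w ⌋ (A ▷ B) → w ⊩ A ▷ B
  truth-▷-member {A} {B} B∈D IA IB w h u w≺u fa = V , wSu , λ v p → proj₂ (IB v) (proj₁ p)
    where
    V : BWorld → Set
    V v = ⌊ v ⌋ B × w ≺ v
    wSu : Sᵇ w u V
    wSu = w≺u , (λ x p → proj₂ p) , λ b pu →
      let open Existence w (holds b) B B∈D
                (λ S' as hb → World.not-both u (proj₁ (IA u) fa) (proj₁ (pu S' as A (▷-transᵂ w h hb))))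
          (v , pv , v∋B) = witness
      in v , (v∋B , Prec-≺ {holds b} {w} {v} pv) , pv

  -- if A ▷ B ∉ w, the existence lemma for S = {¬B} gives u ∋ A with w ≺_S u;
  -- any S_w-successor set of u then contains some v with ¬B ∈ v
  truth-▷-forced : ∀ {A B} → A ∈ D → TruthFor A → TruthFor B → ∀ w → w ⊩ A ▷ B → ⌊ w ⌋ (A ▷ B)
  truth-▷-forced {A} {B} A∈D IA IB w f with lem {P = ⌊ w ⌋ (A ▷ B)}
  ... | yes p = p
  ... | no n = ⊥-elim refuted
    where
    ¬B : FmSet
    ¬B F = F ≡ ¬' B
    open Existence w (holds (toBool ¬B)) A A∈D
      (λ S' as h → n (▷-transᵂ w h (⇒-to-▷ᵂ w (⋁¬¬-copies B S' (All.map (λ {x} → toBool-sound ¬B x) as)))))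
    refuted : ⊥
    refuted with witness
    ... | u , pu , u∋A with f u (Prec-≺ {holds (toBool ¬B)} {w} {u} pu) (proj₂ (IA u) u∋A)
    ... | V , s , V⊩B with proj₂ (proj₂ s) (toBool ¬B) pu
    ... | v , v∈V , pv =
      World.not-both v (proj₁ (IB v) (V⊩B v v∈V))
        (proj₁ (pv (¬' B ∷ []) (toBool-complete ¬B (¬' B) refl ∷ []) B
                   (⇒-to-▷ᵂ w (tautology (p₀ ⟶ (¬ₛ ¬ₛ ¬ₛ p₀ ⟶ ⊥ₛ)) (B ∷ [])))))

  truth : ∀ A → A ∈ D → TruthFor A
  truth (var n) A∈D w = lower , lift
  truth ⊥' A∈D w = (λ x → ⊥-elim (lower x)) ,
                   (λ x → ⊥-elim (World.not-both w x (World.∋-theorem w (tautology (¬ₛ ⊥ₛ) []))))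
  truth (A ⇒ B) A⇒B∈D =
    truth-⇒ (truth A (proj₁ (proj₁ sc A⇒B∈D))) (truth B (proj₂ (proj₁ sc A⇒B∈D)))
  truth (A ▷ B) A▷B∈D w =
    truth-▷-forced A∈D IA IB w , truth-▷-member B∈D IA IB w
    where
    A∈D : A ∈ D
    A∈D = proj₁ (proj₂ sc A▷B∈D)
    B∈D : B ∈ D
    B∈D = proj₂ (proj₂ sc A▷B∈D)
    IA : TruthFor A
    IA = truth A A∈D
    IB : TruthFor B
    IB = truth B B∈D

-- Transfer of the frame conditions from the ILX-structure for 𝒟 (worlds are
-- maximal consistent sets, in Set₁) to the Boolean structure (in Set).  The
-- two structures have the same worlds up to extensional equality ≋ of their
-- formula sets; subsets are carried across by ↑ (all ILX-worlds represented
-- in V) and ↓ (squashed into Set by excluded middle).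
module Transfer (X : List Ext) (lem : ∀ {ℓ} → ExcludedMiddle ℓ) (D : List Fm) where
  open Theories X using (complete-maximal)
  open Lindenbaum X lem using (mcs-complete)
  open BooleanStructure X lem D
  open CanonicalModel X lem D using (model)
  open ILXStructure X D using (Prec; World; carrier; Sat) renaming (Rel to RelI; S to SI)
  module FI = FrameConditions RelI SI
  module FB = FrameConditions _≺_ Sᵇ

  _≋_ : FmSet → FmSet → Set
  Γ ≋ Δ = Γ ⊆F Δ × Δ ⊆F Γ

  ≋-refl : ∀ {Γ} → Γ ≋ Γ
  ≋-refl = (λ _ z → z) , (λ _ z → z)

  ‖_‖ : ∀ {ℓ} → Set ℓ → Set
  ‖ Q ‖ = True (lem {P = Q})

  squash : ∀ {ℓ} {Q : Set ℓ} → Q → ‖ Q ‖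
  squash {Q = Q} = fromWitness {a? = lem {P = Q}}

  unsquash : ∀ {ℓ} {Q : Set ℓ} → ‖ Q ‖ → Q
  unsquash {Q = Q} = toWitness {a? = lem {P = Q}}

  Prec-target : ∀ S w u u' → u ⊆F u' → Prec S w u → Prec S w u'
  Prec-target S w u u' f p S' as A h = let (x , y) = p S' as A h in f _ x , f _ y

  Prec-source : ∀ S w w' u → w' ⊆F w → Prec S w u → Prec S w' u
  Prec-source S w w' u f p S' as A h = p S' as A (f _ h)

  toILX : BWorld → World
  toILX w = ⌊ w ⌋ , complete-maximal (consistent w) (complete w) , last w , last∈D w , holds-last w

  fromILX : World → BWorld
  fromILX (Γ , mcs , G , G∈D , g) = fromSet Γ (proj₁ mcs) (mcs-complete mcs) G G∈D g

  fromILX-≋ : ∀ x → ⌊ fromILX x ⌋ ≋ carrier x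
  fromILX-≋ (Γ , _) = toBool-sound Γ , toBool-complete Γ

  ≺-RelI : ∀ {b x y} → ⌊ b ⌋ ≋ carrier x → b ≺ y → RelI x (toILX y)
  ≺-RelI {b} {x} {y} e r = lift (Prec-source (λ _ → ⊥) ⌊ b ⌋ (carrier x) ⌊ y ⌋ (proj₂ e) r)

  ↑ : (BWorld → Set) → World → Set₁
  ↑ V x = Lift _ (Σ BWorld λ b → V b × (⌊ b ⌋ ≋ carrier x))

  ↓ : (World → Set₁) → BWorld → Set
  ↓ Z b = ‖ Σ World (λ x → Z x × (⌊ b ⌋ ≋ carrier x)) ‖

  _∩↓_ : (BWorld → Set) → (World → Set₁) → BWorld → Set
  (V ∩↓ Z) b = V b × ↓ Z b

  ↓-represents : ∀ {Z b} → ↓ Z b → Σ World λ x → Z x × (⌊ b ⌋ ≋ carrier x)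
  ↓-represents = unsquash

  ∩↓-⊆ : ∀ {V Z} → FB._⊆_ (V ∩↓ Z) V
  ∩↓-⊆ b = proj₁

  -- a Boolean S-successor set lifts to the ILX-structure; an arbitrary set
  -- Sf of formulas is replaced by its characteristic function
  Sᵇ-↑ : ∀ {w u V} → Sᵇ w u V → SI (toILX w) (toILX u) (↑ V)
  Sᵇ-↑ {w} {u} {V} (r , V≻ , f) =
    lift r ,
    (λ { x (lift (b , b∈V , e)) →
           lift (Prec-target (λ _ → ⊥) ⌊ w ⌋ ⌊ b ⌋ (carrier x) (proj₁ e) (V≻ b b∈V)) }) ,
    λ Sf p → let p' = Prec-antitone {Sf} {holds (toBool Sf)} {⌊ w ⌋} {⌊ u ⌋} (toBool-sound Sf) p
                 (v , v∈V , pv) = f (toBool Sf) p'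
             in toILX v , lift (v , v∈V , ≋-refl) ,
                Prec-antitone {holds (toBool Sf)} {Sf} {⌊ w ⌋} {⌊ v ⌋} (toBool-complete Sf) pv

  SI-↓ : ∀ {w u Z V} → SI (toILX w) (toILX u) Z → (∀ x → Z x → ↑ V x) → Sᵇ w u (V ∩↓ Z)
  SI-↓ {w} {u} {Z} {V} (lift r , Z≻ , f) Z⊆↑V =
    r ,
    (λ b q → let (x , x∈Z , e) = ↓-represents {Z} {b} (proj₂ q)
             in Prec-target (λ _ → ⊥) ⌊ w ⌋ (carrier x) ⌊ b ⌋ (proj₂ e) (lower (Z≻ x x∈Z))) ,
    λ b p → let (x , x∈Z , px) = f (holds b) p
                (v , v∈V , e) = lower (Z⊆↑V x x∈Z)
            in v , (v∈V , squash (x , x∈Z , e)) ,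
               Prec-target (holds b) ⌊ w ⌋ (carrier x) ⌊ v ⌋ (proj₂ e) px

  RImg-↓ : ∀ {V Z u} → FI.RImg⊆ Z (toILX u) → FB.RImg⊆ (V ∩↓ Z) u
  RImg-↓ {V} {Z} rimg v q y r =
    let (x , x∈Z , e) = ↓-represents {Z} {v} (proj₂ q)
    in lower (rimg x x∈Z (toILX y) (≺-RelI {v} {x} {y} e r))

  -- Each condition transfers by lifting the given S-successor set with ↑,
  -- applying the condition in the ILX-structure, and descending the
  -- resulting set V' to V ∩↓ V'.
  transfer-M : FI.Mgen → FB.Mgen
  transfer-M h w u V s with h (toILX w) (toILX u) (↑ V) (Sᵇ-↑ {w} {u} {V} s)
  ... | V' , V'⊆ , s' , rimg =
    V ∩↓ V' , ∩↓-⊆ , SI-↓ {w} {u} {V'} {V} s' V'⊆ , RImg-↓ {V} {V'} {u} rimg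

  transfer-M₀ : FI.M₀gen → FB.M₀gen
  transfer-M₀ h w u x V r₁ r₂ s
    with h (toILX w) (toILX u) (toILX x) (↑ V) (lift r₁) (lift r₂) (Sᵇ-↑ {w} {x} {V} s)
  ... | V' , V'⊆ , s' , rimg =
    V ∩↓ V' , ∩↓-⊆ , SI-↓ {w} {u} {V'} {V} s' V'⊆ , RImg-↓ {V} {V'} {u} rimg

  transfer-P : FI.Pgen → FB.Pgen
  transfer-P h w w' u V r₁ r₂ s
    with h (toILX w) (toILX w') (toILX u) (↑ V) (lift r₁) (lift r₂) (Sᵇ-↑ {w} {u} {V} s)
  ... | V' , V'⊆ , s' = V ∩↓ V' , ∩↓-⊆ , SI-↓ {w'} {u} {V'} {V} s' V'⊆

  transfer-P₀ : FI.P₀gen → FB.P₀gen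
  transfer-P₀ h w x u V Z r₁ r₂ s V→Z
    with h (toILX w) (toILX x) (toILX u) (↑ V) (↑ Z) (lift r₁) (lift r₂) (Sᵇ-↑ {w} {u} {V} s) ↑V→↑Z
    where
    ↑V→↑Z : ∀ v' → ↑ V v' → Σ World λ y → RelI v' y × ↑ Z y
    ↑V→↑Z v' (lift (b , b∈V , e)) =
      let (y , r , y∈Z) = V→Z b b∈V in toILX y , ≺-RelI {b} {v'} {y} e r , lift (y , y∈Z , ≋-refl)
  ... | Z' , Z'⊆ , s' = Z ∩↓ Z' , ∩↓-⊆ , SI-↓ {x} {u} {Z'} {Z} s' Z'⊆

  ⇑ : (BWorld → Set) → World → Set₁
  ⇑ C y = Lift _ (∀ b → ⌊ b ⌋ ≋ carrier y → C b)

  ∉⇑ : ∀ {C y} → ¬ ⇑ C y → Σ BWorld λ b → (⌊ b ⌋ ≋ carrier y) × ¬ C b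
  ∉⇑ {C} {y} y∉ with lem {P = Σ BWorld λ b → (⌊ b ⌋ ≋ carrier y) × ¬ C b}
  ... | yes q = q
  ... | no nq = ⊥-elim (y∉ (lift λ b e → represented b e))
    where
    represented : ∀ b → ⌊ b ⌋ ≋ carrier y → C b
    represented b e with lem {P = C b}
    ... | yes c = c
    ... | no nc = ⊥-elim (nq (b , e , nc))

  -- 𝒞(x,u) ascends: if an S-successor set Z of u missed ⇑ C, choosing
  -- representatives outside C would give a Boolean one missing C
  𝒞-↑ : ∀ {x u C} → FB.𝒞 x u C → FI.𝒞 (toILX x) (toILX u) (⇑ C)
  𝒞-↑ {x} {u} {C} (C⊆R[x] , meets) = ⇑C⊆R[x] , meets⇑
    where
    ⇑C⊆R[x] : ∀ y → ⇑ C y → RelI (toILX x) y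
    ⇑C⊆R[x] y c = lift (Prec-target (λ _ → ⊥) ⌊ x ⌋ ⌊ fromILX y ⌋ (carrier y) (proj₁ (fromILX-≋ y))
                                    (C⊆R[x] (fromILX y) (lower c (fromILX y) (fromILX-≋ y))))
    meets⇑ : (Z : World → Set₁) → SI (toILX x) (toILX u) Z → Σ World λ z → Z z × ⇑ C z
    meets⇑ Z s@(lift r , Z≻ , f) with lem {P = Σ World λ y → Z y × ⇑ C y}
    ... | yes p = p
    ... | no Z∩⇑C=∅ with meets ((λ b → ¬ C b) ∩↓ Z) (SI-↓ {x} {u} {Z} {λ b → ¬ C b} s outside)
      where
      outside : ∀ y → Z y → ↑ (λ b → ¬ C b) y
      outside y y∈Z = let (b , e , nc) = ∉⇑ {C} {y} (λ c → Z∩⇑C=∅ (y , y∈Z , c)) in lift (b , nc , e)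
    ... | z , (z∉C , _) , z∈C = ⊥-elim (z∉C z∈C)

  transfer-R : FI.Rgen → FB.Rgen
  transfer-R h w x u V r₁ r₂ s C c
    with h (toILX w) (toILX x) (toILX u) (↑ V) (lift r₁) (lift r₂) (Sᵇ-↑ {w} {u} {V} s)
           (⇑ C) (𝒞-↑ {x} {u} {C} c)
  ... | U' , U'⊆ , s' , rimg = V ∩↓ U' , ∩↓-⊆ , SI-↓ {w} {x} {U'} {V} s' U'⊆ , R[U]⊆C
    where
    R[U]⊆C : FB.RImg⊆Set (V ∩↓ U') C
    R[U]⊆C v q y r = let (x' , x'∈U' , e) = ↓-represents {U'} {v} (proj₂ q)
                     in lower (rimg x' x'∈U' (toILX y) (≺-RelI {v} {x'} {y} e r)) y ≋-refl

  transfer : ∀ Y → FI.Cond Y → FB.Cond Y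
  transfer M = transfer-M
  transfer M₀ = transfer-M₀
  transfer P = transfer-P
  transfer P₀ = transfer-P₀
  transfer R = transfer-R

  model-sat : Sat → ∀ w₀ → ModelSat X (model w₀)
  model-sat h w₀ Y Y∈X = transfer Y (h Y Y∈X)

subformulas : Fm → List Fm
subformulas (var n) = var n ∷ []
subformulas ⊥' = ⊥' ∷ []
subformulas (A ⇒ B) = (A ⇒ B) ∷ subformulas A ++ subformulas B
subformulas (A ▷ B) = (A ▷ B) ∷ subformulas A ++ subformulas B

subformulas-refl : ∀ A → A ∈ subformulas A
subformulas-refl (var n) = here refl
subformulas-refl ⊥' = here refl
subformulas-refl (A ⇒ B) = here refl
subformulas-refl (A ▷ B) = here refl

subformulas-trans : ∀ {x y} z → x ∈ subformulas y → y ∈ subformulas z → x ∈ subformulas z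
subformulas-trans (var n) h (here refl) = h
subformulas-trans ⊥' h (here refl) = h
subformulas-trans (A ⇒ B) h (here refl) = h
subformulas-trans (A ⇒ B) h (there k) with ∈-++⁻ (subformulas A) k
... | inj₁ k' = there (∈-++⁺ˡ (subformulas-trans A h k'))
... | inj₂ k' = there (∈-++⁺ʳ (subformulas A) (subformulas-trans B h k'))
subformulas-trans (A ▷ B) h (here refl) = h
subformulas-trans (A ▷ B) h (there k) with ∈-++⁻ (subformulas A) k
... | inj₁ k' = there (∈-++⁺ˡ (subformulas-trans A h k'))
... | inj₂ k' = there (∈-++⁺ʳ (subformulas A) (subformulas-trans B h k'))

children-∈ : ∀ {A B C} → C ≡ A ⇒ B ⊎ C ≡ A ▷ B → A ∈ subformulas C × B ∈ subformulas C
children-∈ {A} {B} (inj₁ refl) =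
  there (∈-++⁺ˡ (subformulas-refl A)) , there (∈-++⁺ʳ (subformulas A) (subformulas-refl B))
children-∈ {A} {B} (inj₂ refl) =
  there (∈-++⁺ˡ (subformulas-refl A)) , there (∈-++⁺ʳ (subformulas A) (subformulas-refl B))

module AdequateSet (A₀ : Fm) where

  base : List Fm
  base = ⊥' ∷ subformulas A₀

  base-closed : ∀ {A B C} → C ∈ base → C ≡ A ⇒ B ⊎ C ≡ A ▷ B → A ∈ base × B ∈ base
  base-closed (here refl) (inj₁ ())
  base-closed (here refl) (inj₂ ())
  base-closed (there h) e =
    there (subformulas-trans A₀ (proj₁ (children-∈ e)) h) ,
    there (subformulas-trans A₀ (proj₂ (children-∈ e)) h)

  D : List Fm
  D = base ++ map ¬' base

  in-base : ∀ {x} → x ∈ base → x ∈ D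
  in-base = ∈-++⁺ˡ

  in-negated : ∀ {x} → x ∈ base → ¬' x ∈ D
  in-negated h = ∈-++⁺ʳ base (∈-map⁺ ¬' h)

  subformula-closed : SubformulaClosed D
  subformula-closed {A} {B} = closed-⇒ , closed-▷
    where
    closed-⇒ : (A ⇒ B) ∈ D → A ∈ D × B ∈ D
    closed-⇒ h with ∈-++⁻ base h
    ... | inj₁ k = Product.map in-base in-base (base-closed k (inj₁ refl))
    ... | inj₂ k with ∈-map⁻ ¬' k
    ... | E , E∈base , refl = in-base E∈base , in-base (here refl)
    closed-▷ : (A ▷ B) ∈ D → A ∈ D × B ∈ D
    closed-▷ h with ∈-++⁻ base h
    ... | inj₁ k = Product.map in-base in-base (base-closed k (inj₂ refl))
    ... | inj₂ k with ∈-map⁻ ¬' k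
    ... | E , E∈base , ()

  neg-closed : NegClosed D
  neg-closed {B} h with ∈-++⁻ base h
  neg-closed {B} h | inj₂ k with ∈-map⁻ ¬' k
  ... | E , E∈base , refl = in-base E∈base
  neg-closed {var n} h | inj₁ k = in-negated k
  neg-closed {⊥'} h | inj₁ k = in-negated k
  neg-closed {C ⇒ var n} h | inj₁ k = in-negated k
  neg-closed {C ⇒ ⊥'} h | inj₁ k = in-base (proj₁ (base-closed k (inj₁ refl)))
  neg-closed {C ⇒ (x ⇒ y)} h | inj₁ k = in-negated k
  neg-closed {C ⇒ (x ▷ y)} h | inj₁ k = in-negated k
  neg-closed {C ▷ E} h | inj₁ k = in-negated k

  ⊤∈D : ⊤' ∈ D
  ⊤∈D = in-negated (here refl)

  A₀∈D : A₀ ∈ D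
  A₀∈D = in-base (there (subformulas-refl A₀))

  ¬A₀∈D : ¬' A₀ ∈ D
  ¬A₀∈D = in-negated (there (subformulas-refl A₀))

löb-rule : ∀ {X} E → X ⊢ ¬' (E ∧' □ (¬' E)) → X ⊢ ¬' E
löb-rule {X} E h = mp □¬E→¬E (mp (axL (¬' E)) (nec □¬E→¬E))
  where
  □¬E→¬E : X ⊢ □ (¬' E) ⇒ ¬' E
  □¬E→¬E = mp (tautology (¬ₛ (p₀ ∧ₛ p₁) ⟶ (p₁ ⟶ ¬ₛ p₀)) (E ∷ □ (¬' E) ∷ [])) h

refute-copies : ∀ {X} K L → All (λ F → F ≡ K) L → X ⊢ L ⇒* ⊥' → X ⊢ ¬' K
refute-copies K L as h = ⇒-trans (⋀-copies L as) (mp (⇒*-to-⋀ L ⊥') h)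
  where
  ⋀-copies : ∀ {X} L → All (λ F → F ≡ K) L → X ⊢ K ⇒ ⋀ L
  ⋀-copies [] [] = tautology (p₀ ⟶ ¬ₛ ⊥ₛ) (K ∷ [])
  ⋀-copies (_ ∷ L) (refl ∷ as) =
    mp (tautology ((p₀ ⟶ p₁) ⟶ (p₀ ⟶ (p₀ ∧ₛ p₁))) (K ∷ ⋀ L ∷ [])) (⋀-copies L as)

löb-seed-consistent : ∀ {X} A → ¬ (X ⊢ A) → Consistent X (λ F → F ≡ ¬' A ∧' □ (¬' (¬' A)))
löb-seed-consistent A ⊬A (L , as , h) =
  ⊬A (mp (tautology (¬ₛ ¬ₛ p₀ ⟶ p₀) (A ∷ [])) (löb-rule (¬' A) (refute-copies _ L as h)))

refuting-world : (lem : ∀ {ℓ} → ExcludedMiddle ℓ) (X : List Ext) (A : Fm) → ¬ (X ⊢ A) →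
                 Σ (BooleanStructure.BWorld X lem (AdequateSet.D A)) λ w →
                   BooleanStructure.⌊_⌋ X lem (AdequateSet.D A) w (¬' A)
refuting-world lem X A ⊬A with Lindenbaum.lindenbaum X lem (löb-seed-consistent A ⊬A)
... | Δ , seed⊆Δ , cΔ , kΔ = fromSet Δ cΔ kΔ (¬' A) ¬A₀∈D Δ∋seed , toBool-complete Δ (¬' A) Δ∋¬A
  where
  open AdequateSet A
  open BooleanStructure X lem D using (fromSet; toBool-complete)
  Δ∋seed : Δ (¬' A ∧' □ (¬' (¬' A)))
  Δ∋seed = seed⊆Δ _ refl
  Δ∋¬A : Δ (¬' A)
  Δ∋¬A = Theories.Closure.∋-⇒ X cΔ kΔ (∧-elimˡ (¬' A) (□ (¬' (¬' A)))) Δ∋seed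

mainTheorem13 : (∀ {ℓ : Level} → ExcludedMiddle ℓ) →
    (X : List Ext) →
    ((D : List Fm) → SubformulaClosed D → NegClosed D → ⊤' ∈ D →
       ILXStructure.Sat X D) →
    (A : Fm) →
    ((𝔐 : GenModel) → ModelSat X 𝔐 → ∀ w → GenModel._⊩_ 𝔐 w A) →
    X ⊢ A
mainTheorem13 lem X structures-sat A valid with lem {P = X ⊢ A}
... | yes ⊢A = ⊢A
... | no ⊬A with refuting-world lem X A ⊬A
...   | w₀ , w₀∋¬A = ⊥-elim (World.not-both w₀ w₀∋A w₀∋¬A)
  where
  open AdequateSet A
  open BooleanStructure X lem D using (module World; ⌊_⌋)
  open CanonicalModel X lem D using (model)
  open Transfer X lem D using (model-sat)
  open TruthLemma X lem D subformula-closed w₀ using (truth)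
  w₀⊩A : GenModel._⊩_ (model w₀) w₀ A
  w₀⊩A = valid (model w₀) (model-sat (structures-sat D subformula-closed neg-closed ⊤∈D) w₀) w₀
  w₀∋A : ⌊ w₀ ⌋ A
  w₀∋A = proj₁ (truth A A₀∈D w₀) w₀⊩A
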